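{- Let $\mathsf{C}$ be a conceptual structures category and let $\mathsf{Adj}(\mathsf{C})_{=}$ be the category of posetal $\mathsf{C}$-objects and $\mathsf{C}$-adjunctions between them. Then the class of reflections and the class of coreflections (between posetal objects) form a factorization system $\langle \mathsf{Ref}(\mathsf{C}), \mathsf{Ref}(\mathsf{C})^\propto \rangle$ on $\mathsf{Adj}(\mathsf{C})_{=}$. Moreover, each of the three polar factorizations (closed, open, full) described below provides, for every adjunction $g : A_0 \rightleftharpoons A_1$ in $\mathsf{Adj}(\mathsf{C})_{=}$, a reflection–coreflection factorization of $g$ through a posetal object, so that each makes this a factorization system with choice: (closed) $g = \mathsf{ref}^\bullet_g \circ \mathsf{ref}^{\bullet\propto}_g : A_0 \rightleftharpoons \mathsf{clo}(g) \rightleftharpoons A_1$; (open) $g = \mathsf{ref}^\circ_g \circ \mathsf{ref}^{\circ\propto}_g : A_0 \rightleftharpoons \mathsf{open}(g) \rightleftharpoons A_1$; (full) $g = \mathsf{ref}_g \circ \mathsf{ref}^{\propto}_g : A_0 \rightleftharpoons \diamondsuit(g) \rightleftharpoons A_1$.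
   Context: Composition is diagrammatic: $f \cdot g$ means first $f$, then $g$. A CS category $\mathsf{C}$ is an order-enriched category (preordered hom-sets, monotone composition) with finite limits. An object $A$ is posetal if every hom-preorder $\mathsf{C}(X,A)$ is a partial order. A $\mathsf{C}$-adjunction $g = \langle \check g, \hat g\rangle : A \rightleftharpoons B$ has $\check g : A \rightarrow B$, $\hat g : B \rightarrow A$ with $1_A \leq \check g \cdot \hat g$, $\hat g \cdot \check g \leq 1_B$; composition $g \circ h = \langle \check g \cdot \check h, \hat h \cdot \hat g\rangle$. Reflection: $\hat g \cdot \check g = 1_B$; coreflection: $\check g \cdot \hat g = 1_A$. Isomorphisms of $\mathsf{Adj}(\mathsf{C})_{=}$ are adjunctions $\langle f, f^{ -1}\rangle$ with $f$ a $\mathsf{C}$-isomorphism. A factorization system $\langle \mathsf{E}, \mathsf{M}\rangle$ on a category: both classes contain all isomorphisms and are closed under composition; every morphism $f$ factors as $f = e \cdot m$ with $e \in \mathsf{E}$, $m \in \mathsf{M}$; and for every commutative square $e \cdot s = r \cdot m$ with $e \in \mathsf{E}$, $m \in \mathsf{M}$ there is a unique $d$ with $e \cdot d = r$ and $d \cdot m = s$. "With choice" means a specified factorization is chosen for each morphism. Constructions for $g : A_0 \rightleftharpoons A_1$ with $A_0, A_1$ posetal. Closure $(\mbox{ - })^{\bullet_g} = \check g \cdot \hat g : A_0 \rightarrow A_0$; interior $(\mbox{ - })^{\circ_g} = \hat g \cdot \check g : A_1 \rightarrow A_1$. Let $\mathrm{incl}_0 : \mathsf{clo}(g) \rightarrow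 A_0$ be an equalizer of $1_{A_0}$ and $(\mbox{ - })^{\bullet_g}$, and $(\mbox{ - })_0^{\bullet} : A_0 \rightarrow \mathsf{clo}(g)$ the unique morphism with $(\mbox{ - })_0^{\bullet}\cdot\mathrm{incl}_0 = (\mbox{ - })^{\bullet_g}$. Let $\mathrm{incl}_1 : \mathsf{open}(g) \rightarrow A_1$ be an equalizer of $1_{A_1}$ and $(\mbox{ - })^{\circ_g}$, and $(\mbox{ - })_1^{\circ} : A_1 \rightarrow \mathsf{open}(g)$ the unique morphism with $(\mbox{ - })_1^{\circ}\cdot\mathrm{incl}_1 = (\mbox{ - })^{\circ_g}$. Closed reflection $\mathsf{ref}^\bullet_g = \langle (\mbox{ - })_0^\bullet, \mathrm{incl}_0\rangle$; closed coreflection $\mathsf{ref}^{\bullet\propto}_g = \langle \mathrm{incl}_0\cdot\check g, \hat g \cdot (\mbox{ - })_0^\bullet\rangle$. Open reflection $\mathsf{ref}^\circ_g = \langle \check g \cdot (\mbox{ - })_1^\circ, \mathrm{incl}_1 \cdot \hat g\rangle$; open coreflection $\mathsf{ref}^{\circ\propto}_g = \langle \mathrm{incl}_1, (\mbox{ - })_1^\circ\rangle$. The axis $\diamondsuit(g)$ is the limit of the diagram consisting of the morphisms $\mathrm{incl}_0 : \mathsf{clo}(g) \rightarrow A_0$, $\mathrm{incl}_1\cdot\hat g : \mathsf{open}(g) \rightarrow A_0$, $\mathrm{incl}_0\cdot\check g : \mathsf{clo}(g) \rightarrow A_1$, $\mathrm{incl}_1 : \mathsf{open}(g) \rightarrow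 A_1$, with projections $\tilde\pi_0 : \diamondsuit(g) \rightarrow \mathsf{clo}(g)$, $\tilde\pi_1 : \diamondsuit(g) \rightarrow \mathsf{open}(g)$; put $\pi_0 = \tilde\pi_0\cdot\mathrm{incl}_0$, $\pi_1 = \tilde\pi_1\cdot\mathrm{incl}_1$; let $\xi_0 : A_0 \rightarrow \diamondsuit(g)$ be the unique morphism with $\xi_0\cdot\tilde\pi_0 = (\mbox{ - })_0^\bullet$, $\xi_0\cdot\tilde\pi_1 = \check g\cdot(\mbox{ - })_1^\circ$, and $\xi_1 : A_1 \rightarrow \diamondsuit(g)$ the unique morphism with $\xi_1\cdot\tilde\pi_0 = \hat g\cdot(\mbox{ - })_0^\bullet$, $\xi_1\cdot\tilde\pi_1 = (\mbox{ - })_1^\circ$. Extent reflection $\mathsf{ref}_g = \langle \xi_0, \pi_0\rangle$; intent coreflection $\mathsf{ref}^\propto_g = \langle \pi_1, \xi_1\rangle$. -}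

module Defs where

open import Level using (Level; _⊔_; suc)
open import Data.Product using (Σ; Σ-syntax; _×_; _,_; proj₁; proj₂)
open import Relation.Binary.PropositionalEquality using (_≡_; refl; sym; trans; cong; subst)

-- Order-enriched categories (diagrammatic composition: f · g = first f, then g)
-- with finite limits ("conceptual structures" (CS) categories).
-- Equality of morphisms is propositional equality.

record CSCategory (o h r : Level) : Set (suc (o ⊔ h ⊔ r)) where
  infixr 9 _·_
  infix 4 _≤_
  field
    Obj  : Set o
    Hom  : Obj → Obj → Set h
    id   : ∀ {A} → Hom A A
    _·_  : ∀ {A B C} → Hom A B → Hom B C → Hom A C
    idˡ  : ∀ {A B} (f : Hom A B) → id · f ≡ f
    idʳ  : ∀ {A B} (f : Hom A B) → f · id ≡ f
    assoc : ∀ {A B C D} (f : Hom A B) (g : Hom B C) (k : Hom C D) →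
            (f · g) · k ≡ f · (g · k)
    _≤_  : ∀ {A B} → Hom A B → Hom A B → Set r
    ≤-refl  : ∀ {A B} {f : Hom A B} → f ≤ f
    ≤-trans : ∀ {A B} {f g k : Hom A B} → f ≤ g → g ≤ k → f ≤ k
    ·-mono  : ∀ {A B C} {f f' : Hom A B} {g g' : Hom B C} →
              f ≤ f' → g ≤ g' → f · g ≤ f' · g'
    𝟙   : Obj
    !   : ∀ {A} → Hom A 𝟙
    !-unique : ∀ {A} (f : Hom A 𝟙) → f ≡ !
    _⊗_ : Obj → Obj → Obj
    fst : ∀ {A B} → Hom (A ⊗ B) A
    snd : ∀ {A B} → Hom (A ⊗ B) B
    ⟨_,_⟩ : ∀ {X A B} → Hom X A → Hom X B → Hom X (A ⊗ B)
    ⟨⟩-fst : ∀ {X A B} (f : Hom X A) (g : Hom X B) → ⟨ f , g ⟩ · fst ≡ f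
    ⟨⟩-snd : ∀ {X A B} (f : Hom X A) (g : Hom X B) → ⟨ f , g ⟩ · snd ≡ g
    ⟨⟩-unique : ∀ {X A B} (f : Hom X A) (g : Hom X B) (u : Hom X (A ⊗ B)) →
                u · fst ≡ f → u · snd ≡ g → u ≡ ⟨ f , g ⟩
    Eq    : ∀ {A B} → Hom A B → Hom A B → Obj
    eq    : ∀ {A B} (f g : Hom A B) → Hom (Eq f g) A
    eq-eq : ∀ {A B} (f g : Hom A B) → eq f g · f ≡ eq f g · g
    eq-lift : ∀ {X A B} (f g : Hom A B) (x : Hom X A) → x · f ≡ x · g → Hom X (Eq f g)
    eq-lift-β : ∀ {X A B} (f g : Hom A B) (x : Hom X A) (p : x · f ≡ x · g) →
                eq-lift f g x p · eq f g ≡ x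
    eq-lift-unique : ∀ {X A B} (f g : Hom A B) (x : Hom X A) (p : x · f ≡ x · g)
                     (u : Hom X (Eq f g)) → u · eq f g ≡ x → u ≡ eq-lift f g x p

module CSNotions {o h r} (C : CSCategory o h r) where
  open CSCategory C

  ≤-reflexive : ∀ {A B} {f g : Hom A B} → f ≡ g → f ≤ g
  ≤-reflexive refl = ≤-refl

  Posetal : Obj → Set (o ⊔ h ⊔ r)
  Posetal A = ∀ {X} (f g : Hom X A) → f ≤ g → g ≤ f → f ≡ g

  record PObj : Set (o ⊔ h ⊔ r) where
    constructor pobj
    field
      obj     : Obj
      posetal : Posetal obj
  open PObj public

  record IsAdj {A B : Obj} (l : Hom A B) (u : Hom B A) : Set r where
    constructor isAdj
    field
      unit   : id ≤ l · u
      counit : u · l ≤ id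

  record Adj (A B : Obj) : Set (h ⊔ r) where
    constructor adj
    field
      check : Hom A B
      hat   : Hom B A
      isAdjunction : IsAdj check hat
  open Adj public

  _≈_ : ∀ {A B} → Adj A B → Adj A B → Set h
  g ≈ k = (check g ≡ check k) × (hat g ≡ hat k)

  _∘_ : ∀ {A B D} → Adj A B → Adj B D → Adj A D
  adj gc gh (isAdj gu gco) ∘ adj kc kh (isAdj ku kco) =
    adj (gc · kc) (kh · gh) (isAdj u co)
    where
    u : id ≤ (gc · kc) · (kh · gh)
    u = ≤-trans gu
          (≤-trans (≤-reflexive (cong (gc ·_) (sym (idˡ gh))))
          (≤-trans (·-mono (≤-refl {f = gc}) (·-mono ku (≤-refl {f = gh})))
          (≤-reflexive (trans (cong (gc ·_) (assoc kc kh gh))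
                              (sym (assoc gc kc (kh · gh)))))))
    co : (kh · gh) · (gc · kc) ≤ id
    co = ≤-trans (≤-reflexive (trans (assoc kh gh (gc · kc))
                                     (cong (kh ·_) (sym (assoc gh gc kc)))))
          (≤-trans (·-mono (≤-refl {f = kh}) (·-mono gco (≤-refl {f = kc})))
          (≤-trans (≤-reflexive (cong (kh ·_) (idˡ kc))) kco))

  IsReflection : ∀ {A B} → Adj A B → Set h
  IsReflection g = hat g · check g ≡ id

  IsCoreflection : ∀ {A B} → Adj A B → Set h
  IsCoreflection g = check g · hat g ≡ id

  IsIsoAdj : ∀ {A B} → Adj A B → Set h
  IsIsoAdj g = (check g · hat g ≡ id) × (hat g · check g ≡ id)

  record IsFactorizationSystem
      (E M : ∀ {A B} → Adj A B → Set h) : Set (o ⊔ h ⊔ r) where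
    field
      iso-E : ∀ {A B : PObj} (g : Adj (obj A) (obj B)) → IsIsoAdj g → E g
      iso-M : ∀ {A B : PObj} (g : Adj (obj A) (obj B)) → IsIsoAdj g → M g
      comp-E : ∀ {A B D : PObj} (g : Adj (obj A) (obj B)) (k : Adj (obj B) (obj D)) →
               E g → E k → E (g ∘ k)
      comp-M : ∀ {A B D : PObj} (g : Adj (obj A) (obj B)) (k : Adj (obj B) (obj D)) →
               M g → M k → M (g ∘ k)
      factor : ∀ {A B : PObj} (g : Adj (obj A) (obj B)) →
               Σ[ X ∈ PObj ] Σ[ e ∈ Adj (obj A) (obj X) ] Σ[ m ∈ Adj (obj X) (obj B) ]
                 (E e × M m × ((e ∘ m) ≈ g))
      diagonal : ∀ {A B X D : PObj}
                 (e : Adj (obj A) (obj B)) (s : Adj (obj B) (obj D))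
                 (q : Adj (obj A) (obj X)) (m : Adj (obj X) (obj D)) →
                 E e → M m → (e ∘ s) ≈ (q ∘ m) →
                 Σ[ d ∈ Adj (obj B) (obj X) ]
                   (((e ∘ d) ≈ q) × ((d ∘ m) ≈ s) ×
                    (∀ (d' : Adj (obj B) (obj X)) → (e ∘ d') ≈ q → (d' ∘ m) ≈ s → d' ≈ d))

  RefCorefFactorization : ∀ {A B} (g : Adj A B) (X : Obj)
    (e₁ : Hom A X) (e₂ : Hom X A) (m₁ : Hom X B) (m₂ : Hom B X) → Set (o ⊔ h ⊔ r)
  RefCorefFactorization g X e₁ e₂ m₁ m₂ =
    Posetal X ×
    Σ[ a ∈ IsAdj e₁ e₂ ] Σ[ b ∈ IsAdj m₁ m₂ ]
      (IsReflection (adj e₁ e₂ a) × IsCoreflection (adj m₁ m₂ b) ×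
       ((adj e₁ e₂ a ∘ adj m₁ m₂ b) ≈ g))

  IsEqualizer : ∀ {E A B} (f k : Hom A B) (e : Hom E A) → Set (o ⊔ h)
  IsEqualizer {E} {A} f k e =
    (e · f ≡ e · k) ×
    (∀ {X} (x : Hom X A) → x · f ≡ x · k →
       Σ[ u ∈ Hom X E ] ((u · e ≡ x) × (∀ (u' : Hom X E) → u' · e ≡ x → u' ≡ u)))

  closure : ∀ {A₀ A₁} → Adj A₀ A₁ → Hom A₀ A₀
  closure g = check g · hat g

  interior : ∀ {A₀ A₁} → Adj A₀ A₁ → Hom A₁ A₁
  interior g = hat g · check g

  -- (D, t₀, t₁) is a limit of the diagram
  --   incl₀ : Clo → A₀, incl₁ · ĝ : Open → A₀, incl₀ · ǧ : Clo → A₁, incl₁ : Open → A₁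
  -- (the cone legs into A₀ and A₁ are determined by t₀ and t₁)
  IsAxisLimit : ∀ {A₀ A₁ Clo Opn D} (g : Adj A₀ A₁)
    (incl₀ : Hom Clo A₀) (incl₁ : Hom Opn A₁) (t₀ : Hom D Clo) (t₁ : Hom D Opn) →
    Set (o ⊔ h)
  IsAxisLimit {A₀} {A₁} {Clo} {Opn} {D} g incl₀ incl₁ t₀ t₁ =
    ((t₀ · incl₀ ≡ t₁ · (incl₁ · hat g)) × (t₀ · (incl₀ · check g) ≡ t₁ · incl₁)) ×
    (∀ {X} (p₀ : Hom X Clo) (p₁ : Hom X Opn) →
       p₀ · incl₀ ≡ p₁ · (incl₁ · hat g) → p₀ · (incl₀ · check g) ≡ p₁ · incl₁ →
       Σ[ u ∈ Hom X D ] ((u · t₀ ≡ p₀) × (u · t₁ ≡ p₁) ×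
         (∀ (u' : Hom X D) → u' · t₀ ≡ p₀ → u' · t₁ ≡ p₁ → u' ≡ u)))

-- Any four morphisms with e₂e₁ = 1, m₁m₂ = 1, e₁m₁ = ǧ and m₂e₂ = ĝ form a reflection
-- followed by a coreflection composing to g = ⟨ǧ, ĝ⟩: the remaining adjunction inequalities
-- are those of g, because e₁e₂ = ǧĝ and m₂m₁ = ĝǧ. Between posetal objects g satisfies the
-- triangle identities ǧĝǧ = ǧ and ĝǧĝ = ĝ, and these make any splitting of the closure ǧĝ
-- (through clo(g)), of the interior ĝǧ (through open(g)), or of both at once (through the
-- axis) produce such data. The diagonal of a square e ∘ s = q ∘ m is ⟨ê q̌, q̂ ě⟩, unique
-- because a reflection e is left-cancellable.
module Submission where

open import Level using (_⊔_)
open import Defs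
open import Data.Product using (Σ-syntax; _×_; _,_; proj₁; proj₂)
open import Relation.Binary.PropositionalEquality
  using (_≡_; refl; sym; trans; cong; cong₂; module ≡-Reasoning)

module Factorization {o h r} (C : CSCategory o h r) where
  open CSCategory C
  open CSNotions C
  open ≡-Reasoning

  assoc-middle : ∀ {A B D E F} (x : Hom A B) (f : Hom B D) (k : Hom D E) (y : Hom E F) →
                 (x · f) · (k · y) ≡ x · ((f · k) · y)
  assoc-middle x f k y = trans (assoc x f (k · y)) (cong (x ·_) (sym (assoc f k y)))

  cancelʳ : ∀ {A B D} {f : Hom B D} {k : Hom D B} (x : Hom A B) → f · k ≡ id → (x · f) · k ≡ x
  cancelʳ {f = f} {k} x fk = trans (assoc x f k) (trans (cong (x ·_) fk) (idʳ x))

  cancelˡ : ∀ {A B D} {f : Hom A B} {k : Hom B A} (y : Hom A D) → f · k ≡ id → f · (k · y) ≡ y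
  cancelˡ {f = f} {k} y fk = trans (sym (assoc f k y)) (trans (cong (_· y) fk) (idˡ y))

  cancel-middle : ∀ {A B D E} {f : Hom B D} {k : Hom D B} (x : Hom A B) (y : Hom B E) →
                  f · k ≡ id → (x · f) · (k · y) ≡ x · y
  cancel-middle {f = f} {k} x y fk = trans (assoc x f (k · y)) (cong (x ·_) (cancelˡ y fk))

  retract-compose : ∀ {A B D} {s : Hom A B} {r : Hom B A} {s' : Hom B D} {r' : Hom D B} →
                    r · s ≡ id → r' · s' ≡ id → (r' · r) · (s · s') ≡ id
  retract-compose {s' = s'} {r'} rs r's' = trans (cancel-middle r' s' rs) r's'

  check-hat-check : ∀ {A₀ A₁} → Posetal A₁ → (g : Adj A₀ A₁) →
                    check g · (hat g · check g) ≡ check g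
  check-hat-check P₁ (adj ǧ ĝ (isAdj unit counit)) = P₁ _ _
    (≤-trans (·-mono (≤-refl {f = ǧ}) counit) (≤-reflexive (idʳ ǧ)))
    (≤-trans (≤-reflexive (sym (idˡ ǧ)))
      (≤-trans (·-mono unit (≤-refl {f = ǧ})) (≤-reflexive (assoc ǧ ĝ ǧ))))

  hat-check-hat : ∀ {A₀ A₁} → Posetal A₀ → (g : Adj A₀ A₁) →
                  hat g · (check g · hat g) ≡ hat g
  hat-check-hat P₀ (adj ǧ ĝ (isAdj unit counit)) = P₀ _ _
    (≤-trans (≤-reflexive (sym (assoc ĝ ǧ ĝ)))
      (≤-trans (·-mono counit (≤-refl {f = ĝ})) (≤-reflexive (idˡ ĝ))))
    (≤-trans (≤-reflexive (sym (idʳ ĝ))) (·-mono (≤-refl {f = ĝ}) unit))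

  closure-idempotent : ∀ {A₀ A₁} → Posetal A₀ → (g : Adj A₀ A₁) →
                       closure g · closure g ≡ closure g
  closure-idempotent P₀ g =
    trans (assoc (check g) (hat g) (closure g)) (cong (check g ·_) (hat-check-hat P₀ g))

  Monic : ∀ {E A} → Hom E A → Set (o ⊔ h)
  Monic {E} e = ∀ {Y} (u v : Hom Y E) → u · e ≡ v · e → u ≡ v

  JointlyMonic : ∀ {D A B} → Hom D A → Hom D B → Set (o ⊔ h)
  JointlyMonic {D} f k = ∀ {Y} (u v : Hom Y D) → u · f ≡ v · f → u · k ≡ v · k → u ≡ v

  section-monic : ∀ {A E} {i : Hom E A} {c : Hom A E} → i · c ≡ id → Monic i
  section-monic {i = i} {c} ic u v ui≡vi = begin
    u             ≡⟨ sym (cancelʳ u ic) ⟩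
    (u · i) · c   ≡⟨ cong (_· c) ui≡vi ⟩
    (v · i) · c   ≡⟨ cancelʳ v ic ⟩
    v             ∎

  monic-posetal : ∀ {E A} {e : Hom E A} → Posetal A → Monic e → Posetal E
  monic-posetal {e = e} P mono u v u≤v v≤u =
    mono u v (P _ _ (·-mono u≤v (≤-refl {f = e})) (·-mono v≤u (≤-refl {f = e})))

  jointlyMonic-posetal : ∀ {D A B} {f : Hom D A} {k : Hom D B} →
                         Posetal A → Posetal B → JointlyMonic f k → Posetal D
  jointlyMonic-posetal {f = f} {k} P Q mono u v u≤v v≤u = mono u v
    (P _ _ (·-mono u≤v (≤-refl {f = f})) (·-mono v≤u (≤-refl {f = f})))
    (Q _ _ (·-mono u≤v (≤-refl {f = k})) (·-mono v≤u (≤-refl {f = k})))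

  equalizer-monic : ∀ {E A B} {f k : Hom A B} {e : Hom E A} → IsEqualizer f k e → Monic e
  equalizer-monic {f = f} {k} {e} (e-equalizes , universal) u v u·e≡v·e
    with universal (u · e) (trans (assoc u e f) (trans (cong (u ·_) e-equalizes) (sym (assoc u e k))))
  ... | _ , _ , unique = trans (unique u refl) (sym (unique v (sym u·e≡v·e)))

  equalizer-section : ∀ {A E} {k : Hom A A} {i : Hom E A} {c : Hom A E} →
                      IsEqualizer id k i → c · i ≡ k → i · c ≡ id
  equalizer-section {k = k} {i} {c} equalizer@(i-equalizes , _) c·i≡k =
    equalizer-monic equalizer (i · c) id (begin
      (i · c) · i   ≡⟨ assoc i c i ⟩
      i · (c · i)   ≡⟨ cong (i ·_) c·i≡k ⟩
      i · k         ≡⟨ sym i-equalizes ⟩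
      i · id        ≡⟨ idʳ i ⟩
      i             ≡⟨ sym (idˡ i) ⟩
      id · i        ∎)

  refCorefFactorization : ∀ {A B X} (g : Adj A B)
    {e₁ : Hom A X} {e₂ : Hom X A} {m₁ : Hom X B} {m₂ : Hom B X} → Posetal X →
    e₂ · e₁ ≡ id → m₁ · m₂ ≡ id → e₁ · m₁ ≡ check g → m₂ · e₂ ≡ hat g →
    RefCorefFactorization g X e₁ e₂ m₁ m₂
  refCorefFactorization g {e₁} {e₂} {m₁} {m₂} P e-refl m-coref e₁m₁≡ǧ m₂e₂≡ĝ =
    P , isAdj e-unit (≤-reflexive e-refl) , isAdj (≤-reflexive (sym m-coref)) m-counit ,
    e-refl , m-coref , e₁m₁≡ǧ , m₂e₂≡ĝ
    where
    closure≡ : closure g ≡ e₁ · e₂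
    closure≡ = trans (cong₂ _·_ (sym e₁m₁≡ǧ) (sym m₂e₂≡ĝ)) (cancel-middle e₁ e₂ m-coref)
    interior≡ : interior g ≡ m₂ · m₁
    interior≡ = trans (cong₂ _·_ (sym m₂e₂≡ĝ) (sym e₁m₁≡ǧ)) (cancel-middle m₂ m₁ e-refl)
    e-unit : id ≤ e₁ · e₂
    e-unit = ≤-trans (IsAdj.unit (isAdjunction g)) (≤-reflexive closure≡)
    m-counit : m₂ · m₁ ≤ id
    m-counit = ≤-trans (≤-reflexive (sym interior≡)) (IsAdj.counit (isAdjunction g))

  closure-split-hat : ∀ {A₀ A₁ X} → Posetal A₀ → (g : Adj A₀ A₁)
    {c : Hom A₀ X} {i : Hom X A₀} → c · i ≡ closure g → (hat g · c) · i ≡ hat g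
  closure-split-hat P₀ g {c} {i} c·i≡ǧĝ =
    trans (assoc (hat g) c i) (trans (cong (hat g ·_) c·i≡ǧĝ) (hat-check-hat P₀ g))

  interior-split-check : ∀ {A₀ A₁ X} → Posetal A₁ → (g : Adj A₀ A₁)
    {o : Hom A₁ X} {i : Hom X A₁} → o · i ≡ interior g → (check g · o) · i ≡ check g
  interior-split-check P₁ g {o} {i} o·i≡ĝǧ =
    trans (assoc (check g) o i) (trans (cong (check g ·_) o·i≡ĝǧ) (check-hat-check P₁ g))

  closure-splitting-factorization : ∀ {A₀ A₁ X} → Posetal A₀ → Posetal A₁ → (g : Adj A₀ A₁)
    {c : Hom A₀ X} {i : Hom X A₀} → i · c ≡ id → c · i ≡ closure g →
    RefCorefFactorization g X c i (i · check g) (hat g · c)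
  closure-splitting-factorization P₀ P₁ g@(adj ǧ ĝ _) {c} {i} i·c≡1 c·i≡ǧĝ =
    refCorefFactorization g (monic-posetal P₀ (section-monic i·c≡1))
      i·c≡1 coreflection c·i·ǧ≡ǧ (closure-split-hat P₀ g c·i≡ǧĝ)
    where
    coreflection : (i · ǧ) · (ĝ · c) ≡ id
    coreflection = begin
      (i · ǧ) · (ĝ · c)    ≡⟨ assoc-middle i ǧ ĝ c ⟩
      i · ((ǧ · ĝ) · c)    ≡⟨ cong (λ z → i · (z · c)) (sym c·i≡ǧĝ) ⟩
      i · ((c · i) · c)    ≡⟨ sym (assoc-middle i c i c) ⟩
      (i · c) · (i · c)    ≡⟨ cong₂ _·_ i·c≡1 i·c≡1 ⟩
      id · id              ≡⟨ idˡ id ⟩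
      id                   ∎
    c·i·ǧ≡ǧ : c · (i · ǧ) ≡ ǧ
    c·i·ǧ≡ǧ = begin
      c · (i · ǧ)    ≡⟨ sym (assoc c i ǧ) ⟩
      (c · i) · ǧ    ≡⟨ cong (_· ǧ) c·i≡ǧĝ ⟩
      (ǧ · ĝ) · ǧ    ≡⟨ assoc ǧ ĝ ǧ ⟩
      ǧ · (ĝ · ǧ)    ≡⟨ check-hat-check P₁ g ⟩
      ǧ              ∎

  interior-splitting-factorization : ∀ {A₀ A₁ X} → Posetal A₀ → Posetal A₁ → (g : Adj A₀ A₁)
    {o : Hom A₁ X} {i : Hom X A₁} → i · o ≡ id → o · i ≡ interior g →
    RefCorefFactorization g X (check g · o) (i · hat g) i o
  interior-splitting-factorization P₀ P₁ g@(adj ǧ ĝ _) {o} {i} i·o≡1 o·i≡ĝǧ =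
    refCorefFactorization g (monic-posetal P₁ (section-monic i·o≡1))
      reflection i·o≡1 (interior-split-check P₁ g o·i≡ĝǧ) o·i·ĝ≡ĝ
    where
    reflection : (i · ĝ) · (ǧ · o) ≡ id
    reflection = begin
      (i · ĝ) · (ǧ · o)    ≡⟨ assoc-middle i ĝ ǧ o ⟩
      i · ((ĝ · ǧ) · o)    ≡⟨ cong (λ z → i · (z · o)) (sym o·i≡ĝǧ) ⟩
      i · ((o · i) · o)    ≡⟨ sym (assoc-middle i o i o) ⟩
      (i · o) · (i · o)    ≡⟨ cong₂ _·_ i·o≡1 i·o≡1 ⟩
      id · id              ≡⟨ idˡ id ⟩
      id                   ∎
    o·i·ĝ≡ĝ : o · (i · ĝ) ≡ ĝ
    o·i·ĝ≡ĝ = begin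
      o · (i · ĝ)    ≡⟨ sym (assoc o i ĝ) ⟩
      (o · i) · ĝ    ≡⟨ cong (_· ĝ) o·i≡ĝǧ ⟩
      (ĝ · ǧ) · ĝ    ≡⟨ assoc ĝ ǧ ĝ ⟩
      ĝ · (ǧ · ĝ)    ≡⟨ hat-check-hat P₀ g ⟩
      ĝ              ∎

  axisLimit-jointlyMonic : ∀ {A₀ A₁ Clo Opn D} {g : Adj A₀ A₁}
    {incl₀ : Hom Clo A₀} {incl₁ : Hom Opn A₁} {t₀ : Hom D Clo} {t₁ : Hom D Opn} →
    IsAxisLimit g incl₀ incl₁ t₀ t₁ → JointlyMonic t₀ t₁
  axisLimit-jointlyMonic {g = g} {incl₀} {incl₁} {t₀} {t₁} ((square₀ , square₁) , universal) u v p₀ p₁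
    with universal (u · t₀) (u · t₁)
           (trans (assoc u t₀ incl₀) (trans (cong (u ·_) square₀) (sym (assoc u t₁ (incl₁ · hat g)))))
           (trans (assoc u t₀ (incl₀ · check g)) (trans (cong (u ·_) square₁) (sym (assoc u t₁ incl₁))))
  ... | _ , _ , _ , unique = trans (unique u refl refl) (sym (unique v (sym p₀) (sym p₁)))

  axis-factorization : ∀ {A₀ A₁ Clo Opn D} → Posetal A₀ → Posetal A₁ → (g : Adj A₀ A₁) →
    {c₀ : Hom A₀ Clo} {incl₀ : Hom Clo A₀} → incl₀ · c₀ ≡ id → c₀ · incl₀ ≡ closure g →
    {o₁ : Hom A₁ Opn} {incl₁ : Hom Opn A₁} → incl₁ · o₁ ≡ id → o₁ · incl₁ ≡ interior g →
    {t₀ : Hom D Clo} {t₁ : Hom D Opn} → IsAxisLimit g incl₀ incl₁ t₀ t₁ →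
    {ξ₀ : Hom A₀ D} → ξ₀ · t₀ ≡ c₀ → ξ₀ · t₁ ≡ check g · o₁ →
    {ξ₁ : Hom A₁ D} → ξ₁ · t₀ ≡ hat g · c₀ → ξ₁ · t₁ ≡ o₁ →
    RefCorefFactorization g D ξ₀ (t₀ · incl₀) (t₁ · incl₁) ξ₁
  axis-factorization {D = D} P₀ P₁ g {c₀} {incl₀} incl₀·c₀≡1 c₀-split {o₁} {incl₁} incl₁·o₁≡1 o₁-split
      {t₀} {t₁} limit@((square₀ , square₁) , _) {ξ₀} ξ₀·t₀≡ ξ₀·t₁≡ {ξ₁} ξ₁·t₀≡ ξ₁·t₁≡ =
    refCorefFactorization g posetal-D reflection coreflection
      (trans (sym (assoc ξ₀ t₁ incl₁)) (trans (cong (_· incl₁) ξ₀·t₁≡) (interior-split-check P₁ g o₁-split)))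
      (trans (sym (assoc ξ₁ t₀ incl₀)) (trans (cong (_· incl₀) ξ₁·t₀≡) (closure-split-hat P₀ g c₀-split)))
    where
    jointlyMonic : JointlyMonic t₀ t₁
    jointlyMonic = axisLimit-jointlyMonic {g = g} limit
    posetal-D : Posetal D
    posetal-D = jointlyMonic-posetal (monic-posetal P₀ (section-monic incl₀·c₀≡1))
                                     (monic-posetal P₁ (section-monic incl₁·o₁≡1)) jointlyMonic
    π₀·c₀≡t₀ : (t₀ · incl₀) · c₀ ≡ t₀
    π₀·c₀≡t₀ = cancelʳ t₀ incl₀·c₀≡1
    π₁·o₁≡t₁ : (t₁ · incl₁) · o₁ ≡ t₁
    π₁·o₁≡t₁ = cancelʳ t₁ incl₁·o₁≡1
    reflection : (t₀ · incl₀) · ξ₀ ≡ id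
    reflection = jointlyMonic _ id
      (begin
        ((t₀ · incl₀) · ξ₀) · t₀         ≡⟨ assoc (t₀ · incl₀) ξ₀ t₀ ⟩
        (t₀ · incl₀) · (ξ₀ · t₀)         ≡⟨ cong ((t₀ · incl₀) ·_) ξ₀·t₀≡ ⟩
        (t₀ · incl₀) · c₀                ≡⟨ π₀·c₀≡t₀ ⟩
        t₀                               ≡⟨ sym (idˡ t₀) ⟩
        id · t₀                          ∎)
      (begin
        ((t₀ · incl₀) · ξ₀) · t₁         ≡⟨ assoc (t₀ · incl₀) ξ₀ t₁ ⟩
        (t₀ · incl₀) · (ξ₀ · t₁)         ≡⟨ cong ((t₀ · incl₀) ·_) ξ₀·t₁≡ ⟩
        (t₀ · incl₀) · (check g · o₁)    ≡⟨ assoc-middle t₀ incl₀ (check g) o₁ ⟩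
        t₀ · ((incl₀ · check g) · o₁)    ≡⟨ sym (assoc t₀ (incl₀ · check g) o₁) ⟩
        (t₀ · (incl₀ · check g)) · o₁    ≡⟨ cong (_· o₁) square₁ ⟩
        (t₁ · incl₁) · o₁                ≡⟨ π₁·o₁≡t₁ ⟩
        t₁                               ≡⟨ sym (idˡ t₁) ⟩
        id · t₁                          ∎)
    coreflection : (t₁ · incl₁) · ξ₁ ≡ id
    coreflection = jointlyMonic _ id
      (begin
        ((t₁ · incl₁) · ξ₁) · t₀         ≡⟨ assoc (t₁ · incl₁) ξ₁ t₀ ⟩
        (t₁ · incl₁) · (ξ₁ · t₀)         ≡⟨ cong ((t₁ · incl₁) ·_) ξ₁·t₀≡ ⟩
        (t₁ · incl₁) · (hat g · c₀)      ≡⟨ assoc-middle t₁ incl₁ (hat g) c₀ ⟩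
        t₁ · ((incl₁ · hat g) · c₀)      ≡⟨ sym (assoc t₁ (incl₁ · hat g) c₀) ⟩
        (t₁ · (incl₁ · hat g)) · c₀      ≡⟨ cong (_· c₀) (sym square₀) ⟩
        (t₀ · incl₀) · c₀                ≡⟨ π₀·c₀≡t₀ ⟩
        t₀                               ≡⟨ sym (idˡ t₀) ⟩
        id · t₀                          ∎)
      (begin
        ((t₁ · incl₁) · ξ₁) · t₁         ≡⟨ assoc (t₁ · incl₁) ξ₁ t₁ ⟩
        (t₁ · incl₁) · (ξ₁ · t₁)         ≡⟨ cong ((t₁ · incl₁) ·_) ξ₁·t₁≡ ⟩
        (t₁ · incl₁) · o₁                ≡⟨ π₁·o₁≡t₁ ⟩
        t₁                               ≡⟨ sym (idˡ t₁) ⟩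
        id · t₁                          ∎)

  eq-isEqualizer : ∀ {A B} (f k : Hom A B) → IsEqualizer f k (eq f k)
  eq-isEqualizer f k = eq-eq f k , λ x p →
    eq-lift f k x p , eq-lift-β f k x p , λ u u·eq≡x → eq-lift-unique f k x p u u·eq≡x

  reflection-cancelˡ : ∀ {A B X} (e : Adj A B) (d : Adj B X) {q : Adj A X} →
    IsReflection e → (e ∘ d) ≈ q → (check d ≡ hat e · check q) × (hat d ≡ hat q · check e)
  reflection-cancelˡ (adj ě ê _) (adj ď d̂ _) ê·ě≡1 (ě·ď≡q̌ , d̂·ê≡q̂) =
    trans (sym (cancelˡ ď ê·ě≡1)) (cong (ê ·_) ě·ď≡q̌) ,
    trans (sym (cancelʳ d̂ ê·ě≡1)) (cong (_· ě) d̂·ê≡q̂)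

  reflection-coreflection-diagonal : ∀ {A B X D}
    (e : Adj A B) (s : Adj B D) (q : Adj A X) (m : Adj X D) →
    IsReflection e → IsCoreflection m → (e ∘ s) ≈ (q ∘ m) →
    Σ[ d ∈ Adj B X ] (((e ∘ d) ≈ q) × ((d ∘ m) ≈ s) ×
      (∀ (d' : Adj B X) → (e ∘ d') ≈ q → (d' ∘ m) ≈ s → d' ≈ d))
  reflection-coreflection-diagonal e@(adj ě ê _) (adj š ŝ (isAdj _ s-counit))
      q@(adj q̌ q̂ (isAdj q-unit _)) (adj m̌ m̂ _) ê·ě≡1 m̌·m̂≡1 (ě·š≡q̌·m̌ , ŝ·ê≡m̂·q̂) =
    adj (ê · q̌) (q̂ · ě) (isAdj unit counit) ,
    (trans (cong (ě ·_) ê·q̌≡š·m̂) (sym q̌≡ě·š·m̂) , trans (cong (_· ê) q̂·ě≡m̌·ŝ) (sym q̂≡m̌·ŝ·ê)) ,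
    (trans (assoc ê q̌ m̌) (trans (cong (ê ·_) (sym ě·š≡q̌·m̌)) (cancelˡ š ê·ě≡1)) ,
     trans (sym (assoc m̂ q̂ ě)) (trans (cong (_· ě) (sym ŝ·ê≡m̂·q̂)) (cancelʳ ŝ ê·ě≡1))) ,
    λ d' e∘d'≈q _ → reflection-cancelˡ e d' {q} ê·ě≡1 e∘d'≈q
    where
    q̌≡ě·š·m̂ : q̌ ≡ ě · (š · m̂)
    q̌≡ě·š·m̂ = begin
      q̌              ≡⟨ sym (cancelʳ q̌ m̌·m̂≡1) ⟩
      (q̌ · m̌) · m̂    ≡⟨ cong (_· m̂) (sym ě·š≡q̌·m̌) ⟩
      (ě · š) · m̂    ≡⟨ assoc ě š m̂ ⟩
      ě · (š · m̂)    ∎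
    q̂≡m̌·ŝ·ê : q̂ ≡ (m̌ · ŝ) · ê
    q̂≡m̌·ŝ·ê = begin
      q̂              ≡⟨ sym (cancelˡ q̂ m̌·m̂≡1) ⟩
      m̌ · (m̂ · q̂)    ≡⟨ cong (m̌ ·_) (sym ŝ·ê≡m̂·q̂) ⟩
      m̌ · (ŝ · ê)    ≡⟨ sym (assoc m̌ ŝ ê) ⟩
      (m̌ · ŝ) · ê    ∎
    ê·q̌≡š·m̂ : ê · q̌ ≡ š · m̂
    ê·q̌≡š·m̂ = trans (cong (ê ·_) q̌≡ě·š·m̂) (cancelˡ (š · m̂) ê·ě≡1)
    q̂·ě≡m̌·ŝ : q̂ · ě ≡ m̌ · ŝ
    q̂·ě≡m̌·ŝ = trans (cong (_· ě) q̂≡m̌·ŝ·ê) (cancelʳ (m̌ · ŝ) ê·ě≡1)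
    unit : id ≤ (ê · q̌) · (q̂ · ě)
    unit = ≤-trans (≤-reflexive (trans (sym ê·ě≡1) (cong (ê ·_) (sym (idˡ ě)))))
      (≤-trans (·-mono (≤-refl {f = ê}) (·-mono q-unit (≤-refl {f = ě})))
               (≤-reflexive (sym (assoc-middle ê q̌ q̂ ě))))
    counit : (q̂ · ě) · (ê · q̌) ≤ id
    counit = ≤-trans (≤-reflexive (trans (cong₂ _·_ q̂·ě≡m̌·ŝ ê·q̌≡š·m̂) (assoc-middle m̌ ŝ š m̂)))
      (≤-trans (·-mono (≤-refl {f = m̌}) (·-mono s-counit (≤-refl {f = m̂})))
               (≤-reflexive (trans (cong (m̌ ·_) (idˡ m̂)) m̌·m̂≡1)))

  ∘-reflection : ∀ {A B D} (g : Adj A B) (k : Adj B D) →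
                 IsReflection g → IsReflection k → IsReflection (g ∘ k)
  ∘-reflection (adj _ _ _) (adj _ _ _) = retract-compose

  ∘-coreflection : ∀ {A B D} (g : Adj A B) (k : Adj B D) →
                   IsCoreflection g → IsCoreflection k → IsCoreflection (g ∘ k)
  ∘-coreflection (adj _ _ _) (adj _ _ _) g-coreflection k-coreflection =
    retract-compose k-coreflection g-coreflection

  closed-factorization : ∀ {A B : PObj} (g : Adj (obj A) (obj B)) →
    Σ[ X ∈ PObj ] Σ[ e ∈ Adj (obj A) (obj X) ] Σ[ m ∈ Adj (obj X) (obj B) ]
      (IsReflection e × IsCoreflection m × ((e ∘ m) ≈ g))
  closed-factorization {pobj A₀ P₀} {pobj A₁ P₁} g
    with closure-splitting-factorization P₀ P₁ g
           (equalizer-section (eq-isEqualizer id (closure g)) c·i≡closure) c·i≡closure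
    where
    closure-equalized : closure g · id ≡ closure g · closure g
    closure-equalized = trans (idʳ (closure g)) (sym (closure-idempotent P₀ g))
    c·i≡closure : eq-lift id (closure g) (closure g) closure-equalized · eq id (closure g) ≡ closure g
    c·i≡closure = eq-lift-β id (closure g) (closure g) closure-equalized
  ... | X-posetal , e-adj , m-adj , e-reflection , m-coreflection , e∘m≈g =
    pobj _ X-posetal , adj _ _ e-adj , adj _ _ m-adj , e-reflection , m-coreflection , e∘m≈g

  reflection-coreflection-factorizationSystem : IsFactorizationSystem IsReflection IsCoreflection
  reflection-coreflection-factorizationSystem = record
    { iso-E    = λ _ → proj₂
    ; iso-M    = λ _ → proj₁
    ; comp-E   = ∘-reflection
    ; comp-M   = ∘-coreflection
    ; factor   = λ {A} {B} → closed-factorization {A} {B}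
    ; diagonal = reflection-coreflection-diagonal
    }

mainTheorem3 : ∀ {o h r} (C : CSCategory o h r) →
    let open CSCategory C
        open CSNotions C
    in
    IsFactorizationSystem IsReflection IsCoreflection
    × (∀ {A₀ A₁} → Posetal A₀ → Posetal A₁ → (g : Adj A₀ A₁) →
         ∀ {Clo} (incl₀ : Hom Clo A₀) → IsEqualizer id (closure g) incl₀ →
         (c₀ : Hom A₀ Clo) → c₀ · incl₀ ≡ closure g →
         RefCorefFactorization g Clo c₀ incl₀ (incl₀ · check g) (hat g · c₀))
    × (∀ {A₀ A₁} → Posetal A₀ → Posetal A₁ → (g : Adj A₀ A₁) →
         ∀ {Opn} (incl₁ : Hom Opn A₁) → IsEqualizer id (interior g) incl₁ →
         (o₁ : Hom A₁ Opn) → o₁ · incl₁ ≡ interior g →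
         RefCorefFactorization g Opn (check g · o₁) (incl₁ · hat g) incl₁ o₁)
    × (∀ {A₀ A₁} → Posetal A₀ → Posetal A₁ → (g : Adj A₀ A₁) →
         ∀ {Clo} (incl₀ : Hom Clo A₀) → IsEqualizer id (closure g) incl₀ →
         (c₀ : Hom A₀ Clo) → c₀ · incl₀ ≡ closure g →
         ∀ {Opn} (incl₁ : Hom Opn A₁) → IsEqualizer id (interior g) incl₁ →
         (o₁ : Hom A₁ Opn) → o₁ · incl₁ ≡ interior g →
         ∀ {D} (t₀ : Hom D Clo) (t₁ : Hom D Opn) → IsAxisLimit g incl₀ incl₁ t₀ t₁ →
         (ξ₀ : Hom A₀ D) → ξ₀ · t₀ ≡ c₀ → ξ₀ · t₁ ≡ check g · o₁ →
         (ξ₁ : Hom A₁ D) → ξ₁ · t₀ ≡ hat g · c₀ → ξ₁ · t₁ ≡ o₁ →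
         RefCorefFactorization g D ξ₀ (t₀ · incl₀) (t₁ · incl₁) ξ₁)
mainTheorem3 C =
  reflection-coreflection-factorizationSystem ,
  (λ P₀ P₁ g _ clo-equalizer _ c₀-split →
     closure-splitting-factorization P₀ P₁ g (equalizer-section clo-equalizer c₀-split) c₀-split) ,
  (λ P₀ P₁ g _ open-equalizer _ o₁-split →
     interior-splitting-factorization P₀ P₁ g (equalizer-section open-equalizer o₁-split) o₁-split) ,
  (λ P₀ P₁ g _ clo-equalizer _ c₀-split _ open-equalizer _ o₁-split _ _ axis _ ξ₀·t₀ ξ₀·t₁ _ ξ₁·t₀ ξ₁·t₁ →
     axis-factorization P₀ P₁ g (equalizer-section clo-equalizer c₀-split) c₀-split
       (equalizer-section open-equalizer o₁-split) o₁-split axis ξ₀·t₀ ξ₀·t₁ ξ₁·t₀ ξ₁·t₁)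
  where open Factorization C
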